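{- Let $d\ge4$ and let $x$ be an integer with $d-3\le x\le d+3$. Then there exists a $d$-dimensional polytope with $d+3$ vertices and exactly $x+\tfrac12 d(d+3)$ edges. -}

module Defs where

open import Data.Nat using (ℕ)
open import Data.Fin using (Fin; toℕ)
open import Data.Product using (Σ; _×_)
open import Data.List using (List; length)
open import Data.List.Membership.Propositional using (_∈_)
open import Data.List.Relation.Unary.Unique.Propositional using (Unique)
open import Data.Rational using (ℚ; 0ℚ; _+_; _*_; _<_)
open import Relation.Binary.PropositionalEquality using (_≡_; _≢_)
open import Function.Bundles using (_⇔_)
import Data.Nat as ℕ

-- Points of ℚ^d and linear functionals on ℚ^d, both as functions Fin d → ℚ.
Point : ℕ → Set
Point d = Fin d → ℚ

sumFin : (d : ℕ) → (Fin d → ℚ) → ℚ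
sumFin ℕ.zero    f = 0ℚ
sumFin (ℕ.suc d) f = f Fin.zero + sumFin d (λ i → f (Fin.suc i))
  where import Data.Fin as Fin

_·_ : {d : ℕ} → Point d → Point d → ℚ
_·_ {d} c p = sumFin d (λ i → c i * p i)

-- A polytope in ℚ^d given by its list of n vertices v : Fin n → ℚ^d.
-- Convex position: every listed point is a vertex of the convex hull, i.e. is the
-- unique maximiser among the listed points of some linear functional.
IsVertexList : {d n : ℕ} → (Fin n → Point d) → Set
IsVertexList {d} {n} v =
  (i : Fin n) → Σ (Point d) λ c → (k : Fin n) → k ≢ i → (c · v k) < (c · v i)

-- Full dimensionality: the vertices lie in no affine hyperplane, i.e. any linear
-- functional constant on all vertices is zero.
IsFullDim : {d n : ℕ} → (Fin n → Point d) → Set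
IsFullDim {d} {n} v =
  (c : Point d) → (z : Fin n) → ((k : Fin n) → (c · v k) ≡ (c · v z)) → (i : Fin d) → c i ≡ 0ℚ

IsPolytope : (d n : ℕ) → (Fin n → Point d) → Set
IsPolytope d n v = IsVertexList v × IsFullDim v

IsEdge : {d n : ℕ} → (Fin n → Point d) → Fin n → Fin n → Set
IsEdge {d} {n} v i j =
  i ≢ j × Σ (Point d) λ c →
    ((c · v i) ≡ (c · v j)) × ((k : Fin n) → k ≢ i → k ≢ j → (c · v k) < (c · v i))

HasEdgeCount : {d n : ℕ} → (Fin n → Point d) → ℕ → Set
HasEdgeCount {d} {n} v m =
  Σ (List (Fin n × Fin n)) λ es →
    Unique es × length es ≡ m ×
    ((i j : Fin n) → ((i Data.Product., j) ∈ es) ⇔ ((toℕ i ℕ.< toℕ j) × IsEdge v i j))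
  where import Data.Product

module Submission where

-- With m = d + 3 - x ∈ {0, …, 6} the required number of edges is C(d + 3, 2) - m: the graph
-- misses exactly m edges. A pyramid raises dimension and number of vertices by one and joins the
-- apex to every vertex, so it preserves the number of missing edges. It therefore suffices to
-- have, for each m ≤ 6, one polytope with three more vertices than its dimension that misses m
-- edges: the cyclic polytope C(7, 4) and two other 4-polytopes with 7 vertices (m = 0, 1, 2), and
-- the octahedron, a stacked square pyramid, the pentagonal pyramid and the triangular prism
-- (m = 3, …, 6). Each is verified by an exact rational certificate: a functional exposing each
-- vertex, a functional supporting each edge, for each non-edge {i, j} an affine dependence of the
-- vertices that is nonnegative and somewhere positive away from i and j, and weight vectors of
-- total 0 combining the vertices into the unit vectors.

open import Defs
open import Data.Nat as ℕ using (ℕ; zero; suc)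

module Geometry where

  open import Algebra.Bundles using (CommutativeRing)
  open import Data.Empty using (⊥-elim)
  open import Data.Fin using (Fin; zero; suc; toℕ)
  open import Data.Fin.Properties using (_≟_; <⇒≢; suc-injective; all?; any?)
  open import Data.List using (List; map; length; _++_; allFin)
  open import Data.List.Properties using (length-map; length-++; length-tabulate)
  open import Data.List.Membership.Propositional using (_∈_)
  open import Data.List.Membership.Propositional.Properties
    using (∈-map⁺; ∈-map⁻; ∈-++⁺ˡ; ∈-++⁺ʳ; ∈-++⁻; ∈-allFin)
  open import Data.List.Membership.DecPropositional using (_∈?_)
  open import Data.List.Relation.Unary.All as All using (All)
  open import Data.List.Relation.Unary.Unique.Propositional using (Unique)
  open import Data.List.Relation.Unary.Unique.Propositional.Properties using (++⁺; map⁺; allFin⁺)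
  open import Data.List.Relation.Unary.Unique.DecPropositional using (unique?)
  open import Data.Product as Product using (∃-syntax; _×_; _,_; proj₁; proj₂)
  open import Data.Product.Properties using (≡-dec)
  open import Data.Rational using (ℚ; 0ℚ; 1ℚ; _+_; _*_; -_; _-_; _<_; _≤_; positive; nonNegative)
  open import Data.Rational.Properties
    using ( +-*-commutativeRing; +-identityˡ; +-identityʳ; +-inverseʳ; *-identityʳ; *-zeroˡ; *-zeroʳ
          ; ≤-refl; ≤-reflexive; <⇒≤; <-irrefl; +-mono-≤; +-mono-<-≤; +-mono-≤-<; +-monoˡ-<; +-monoʳ-<
          ; nonNegative⁻¹; positive⁻¹; negative⁻¹; nonNeg*nonNeg⇒nonNeg; pos*pos⇒pos; _<?_; _≤?_ )
    renaming (_≟_ to _≟ℚ_)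
  open import Data.Rational.Solver using (module +-*-Solver)
  open import Data.Sum using (_⊎_; inj₁; inj₂)
  open import Data.Vec using (Vec; lookup)
  open import Data.Vec.Functional using (_∷_; tail)
  open import Function using (_∘_)
  open import Function.Bundles using (_⇔_; mk⇔; Equivalence)
  open import Relation.Binary.PropositionalEquality
  open import Relation.Nullary using (¬_; Dec; yes; no)
  open import Relation.Nullary.Decidable using (_×-dec_; _→-dec_; _⊎-dec_; ¬?)

  open import Algebra.Properties.Semiring.Sum (CommutativeRing.semiring +-*-commutativeRing)
    using (sum; sum-cong-≗; *-distribˡ-sum; *-distribʳ-sum; ∑-comm; ∑-distrib-+)

  sumFin≡sum : ∀ n (f : Fin n → ℚ) → sumFin n f ≡ sum f
  sumFin≡sum zero    f = refl
  sumFin≡sum (suc n) f = cong (f zero +_) (sumFin≡sum n (f ∘ suc))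

  sum-nonNeg : ∀ {n} (f : Fin n → ℚ) → (∀ k → 0ℚ ≤ f k) → 0ℚ ≤ sum f
  sum-nonNeg {zero}  f f≥0 = ≤-refl
  sum-nonNeg {suc n} f f≥0 = +-mono-≤ (f≥0 zero) (sum-nonNeg (f ∘ suc) (f≥0 ∘ suc))

  sum-pos : ∀ {n} (f : Fin n → ℚ) → (∀ k → 0ℚ ≤ f k) → ∀ k → 0ℚ < f k → 0ℚ < sum f
  sum-pos f f≥0 zero    fk>0 = +-mono-<-≤ fk>0 (sum-nonNeg (f ∘ suc) (f≥0 ∘ suc))
  sum-pos f f≥0 (suc k) fk>0 = +-mono-≤-< (f≥0 zero) (sum-pos (f ∘ suc) (f≥0 ∘ suc) k fk>0)

  p<q⇒0<q-p : ∀ {p q} → p < q → 0ℚ < q - p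
  p<q⇒0<q-p {p} {q} p<q = subst (_< q - p) (+-inverseʳ p) (+-monoˡ-< (- p) p<q)

  *-nonNeg : ∀ {p q} → 0ℚ ≤ p → 0ℚ ≤ q → 0ℚ ≤ p * q
  *-nonNeg {p} {q} p≥0 q≥0 =
    nonNegative⁻¹ _ {{nonNeg*nonNeg⇒nonNeg p {{nonNegative p≥0}} q {{nonNegative q≥0}}}}

  *-pos : ∀ {p q} → 0ℚ < p → 0ℚ < q → 0ℚ < p * q
  *-pos {p} {q} p>0 q>0 = positive⁻¹ _ {{pos*pos⇒pos p {{positive p>0}} q {{positive q>0}}}}

  lincomb : ∀ {d n} → (Fin n → ℚ) → (Fin n → Point d) → Point d
  lincomb α v m = sum (λ k → α k * v k m)

  ·-lincomb : ∀ {d n} (α : Fin n → ℚ) (v : Fin n → Point d) (c : Point d) →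
              sum (λ k → α k * (c · v k)) ≡ c · lincomb α v
  ·-lincomb {d} {n} α v c = begin
    sum (λ k → α k * (c · v k))                   ≡⟨ sum-cong-≗ (λ k → cong (α k *_) (sumFin≡sum d _)) ⟩
    sum (λ k → α k * sum (λ m → c m * v k m))     ≡⟨ sum-cong-≗ (λ k → *-distribˡ-sum {d} (α k) _) ⟩
    sum (λ k → sum (λ m → α k * (c m * v k m)))   ≡⟨ ∑-comm {n} {d} _ ⟩
    sum (λ m → sum (λ k → α k * (c m * v k m)))   ≡⟨ sum-cong-≗ (λ m → sum-cong-≗ λ k → swap (α k) (c m) (v k m)) ⟩
    sum (λ m → sum (λ k → c m * (α k * v k m)))   ≡⟨ sum-cong-≗ (λ m → *-distribˡ-sum {n} (c m) _) ⟨
    sum (λ m → c m * lincomb α v m)               ≡⟨ sumFin≡sum d _ ⟨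
    c · lincomb α v                               ∎
    where
    open ≡-Reasoning
    open +-*-Solver
    swap : ∀ a b x → a * (b * x) ≡ b * (a * x)
    swap = solve 3 (λ a b x → a :* (b :* x) := b :* (a :* x)) refl

  ·-cong : ∀ {d} (c : Point d) {p q : Point d} → (∀ m → p m ≡ q m) → c · p ≡ c · q
  ·-cong {zero}  c p≗q = refl
  ·-cong {suc d} c p≗q = cong₂ _+_ (cong (c zero *_) (p≗q zero)) (·-cong (c ∘ suc) (p≗q ∘ suc))

  ·-zeroʳ : ∀ {d} (c : Point d) {p : Point d} → (∀ m → p m ≡ 0ℚ) → c · p ≡ 0ℚ
  ·-zeroʳ {zero}  c p≗0 = refl
  ·-zeroʳ {suc d} c p≗0 =
    cong₂ _+_ (trans (cong (c zero *_) (p≗0 zero)) (*-zeroʳ (c zero))) (·-zeroʳ (c ∘ suc) (p≗0 ∘ suc))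

  ·-zeroˡ : ∀ {d} {c : Point d} (p : Point d) → (∀ m → c m ≡ 0ℚ) → c · p ≡ 0ℚ
  ·-zeroˡ {zero}  p c≗0 = refl
  ·-zeroˡ {suc d} p c≗0 =
    cong₂ _+_ (trans (cong (_* p zero) (c≗0 zero)) (*-zeroˡ (p zero))) (·-zeroˡ (p ∘ suc) (c≗0 ∘ suc))

  basisVector : ∀ {d} → Fin d → Point d
  basisVector zero    zero    = 1ℚ
  basisVector zero    (suc _) = 0ℚ
  basisVector (suc _) zero    = 0ℚ
  basisVector (suc i) (suc j) = basisVector i j

  ·-basisVector : ∀ {d} (c : Point d) (i : Fin d) → c · basisVector i ≡ c i
  ·-basisVector c zero    =
    trans (cong₂ _+_ (*-identityʳ (c zero)) (·-zeroʳ (c ∘ suc) λ _ → refl)) (+-identityʳ (c zero))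
  ·-basisVector c (suc i) =
    trans (cong₂ _+_ (*-zeroʳ (c zero)) (·-basisVector (c ∘ suc) i)) (+-identityˡ (c (suc i)))

  -- Certificates for vertices, edges, non-edges and full dimension

  IsAffineDependence : ∀ {d n} → (Fin n → Point d) → (Fin n → ℚ) → Set
  IsAffineDependence v α = sum α ≡ 0ℚ × (∀ m → lincomb α v m ≡ 0ℚ)

  affineDependence-annihilates : ∀ {d n} {v : Fin n → Point d} {α : Fin n → ℚ} →
    IsAffineDependence v α → (c : Point d) (t : ℚ) → sum (λ k → α k * (t - c · v k)) ≡ 0ℚ
  affineDependence-annihilates {n = n} {v} {α} (∑α≡0 , ∑αv≡0) c t = begin
    S                                                    ≡⟨ +-identityˡ S ⟨
    0ℚ + S                                               ≡⟨ cong (_+ S) ∑α[c·v]≡0 ⟨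
    sum (λ k → α k * (c · v k)) + S                      ≡⟨ ∑-distrib-+ {n} _ _ ⟨
    sum (λ k → α k * (c · v k) + α k * (t - c · v k))    ≡⟨ sum-cong-≗ (λ k → split (α k) t (c · v k)) ⟩
    sum (λ k → α k * t)                                  ≡⟨ *-distribʳ-sum {n} t α ⟨
    sum α * t                                            ≡⟨ cong (_* t) ∑α≡0 ⟩
    0ℚ * t                                               ≡⟨ *-zeroˡ t ⟩
    0ℚ                                                   ∎
    where
    open ≡-Reasoning
    open +-*-Solver
    S = sum (λ k → α k * (t - c · v k))
    ∑α[c·v]≡0 : sum (λ k → α k * (c · v k)) ≡ 0ℚ
    ∑α[c·v]≡0 = trans (·-lincomb α v c) (·-zeroʳ c ∑αv≡0)
    split : ∀ a t s → a * s + a * (t - s) ≡ a * t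
    split = solve 3 (λ a t s → a :* s :+ a :* (t :- s) := a :* t) refl

  BlocksEdge : ∀ {d n} → (Fin n → Point d) → Fin n → Fin n → (Fin n → ℚ) → Set
  BlocksEdge v i j α =
    IsAffineDependence v α × (∀ k → k ≢ i → k ≢ j → 0ℚ ≤ α k) × ∃[ k ] (k ≢ i × k ≢ j × 0ℚ < α k)

  -- Weighting the gaps t - c · v k of a supporting functional c by α sums to 0 since α is an
  -- affine dependence, but every term is ≥ 0 and the one at k₀ is > 0.
  blocksEdge⇒¬IsEdge : ∀ {d n} {v : Fin n → Point d} {i j : Fin n} {α : Fin n → ℚ} →
                       BlocksEdge v i j α → ¬ IsEdge v i j
  blocksEdge⇒¬IsEdge {n = n} {v} {i} {j} {α}
                     (dep , α≥0 , k₀ , k₀≢i , k₀≢j , αk₀>0) (_ , c , cvi≡cvj , cvk<cvi) =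
    <-irrefl (sym (affineDependence-annihilates {v = v} {α} dep c t)) (sum-pos w w≥0 k₀ wk₀>0)
    where
    t = c · v i
    w : Fin n → ℚ
    w k = α k * (t - c · v k)
    gap>0 : ∀ {k} → k ≢ i → k ≢ j → 0ℚ < t - c · v k
    gap>0 k≢i k≢j = p<q⇒0<q-p (cvk<cvi _ k≢i k≢j)
    w≥0 : ∀ k → 0ℚ ≤ w k
    w≥0 k with k ≟ i | k ≟ j
    ... | yes refl | _        = ≤-reflexive (sym (trans (cong (α k *_) (+-inverseʳ t)) (*-zeroʳ (α k))))
    ... | no _     | yes refl = ≤-reflexive (sym (trans (cong (λ s → α k * (t - s)) (sym cvi≡cvj))
                                                      (trans (cong (α k *_) (+-inverseʳ t)) (*-zeroʳ (α k)))))
    ... | no k≢i   | no k≢j   = *-nonNeg (α≥0 k k≢i k≢j) (<⇒≤ (gap>0 k≢i k≢j))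
    wk₀>0 : 0ℚ < w k₀
    wk₀>0 = *-pos αk₀>0 (gap>0 k₀≢i k₀≢j)

  GeneratesDirections : ∀ {d n} → (Fin n → Point d) → (Fin d → Fin n → ℚ) → Set
  GeneratesDirections v β = ∀ m → sum (β m) ≡ 0ℚ × (∀ m′ → lincomb (β m) v m′ ≡ basisVector m m′)

  generatesDirections⇒IsFullDim : ∀ {d n} {v : Fin n → Point d} {β : Fin d → Fin n → ℚ} →
                                  GeneratesDirections v β → IsFullDim v
  generatesDirections⇒IsFullDim {n = n} {v} {β} gen c z c·v-const m = begin
    c m                                ≡⟨ ·-basisVector c m ⟨
    c · basisVector m                  ≡⟨ ·-cong c (proj₂ (gen m)) ⟨
    c · lincomb (β m) v                ≡⟨ ·-lincomb (β m) v c ⟨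
    sum (λ k → β m k * (c · v k))      ≡⟨ sum-cong-≗ (λ k → cong (β m k *_) (c·v-const k)) ⟩
    sum (λ k → β m k * (c · v z))      ≡⟨ *-distribʳ-sum {n} (c · v z) (β m) ⟨
    sum (β m) * (c · v z)              ≡⟨ cong (_* (c · v z)) (proj₁ (gen m)) ⟩
    0ℚ * (c · v z)                     ≡⟨ *-zeroˡ (c · v z) ⟩
    0ℚ                                 ∎
    where open ≡-Reasoning

  Exposes : ∀ {d n} → (Fin n → Point d) → Fin n → Point d → Set
  Exposes v i c = ∀ k → k ≢ i → c · v k < c · v i

  SupportsEdge : ∀ {d n} → (Fin n → Point d) → Fin n → Fin n → Point d → Set
  SupportsEdge v i j c = c · v i ≡ c · v j × (∀ k → k ≢ i → k ≢ j → c · v k < c · v i)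

  exposes? : ∀ {d n} (v : Fin n → Point d) i c → Dec (Exposes v i c)
  exposes? v i c = all? λ k → ¬? (k ≟ i) →-dec (c · v k <? c · v i)

  supportsEdge? : ∀ {d n} (v : Fin n → Point d) i j c → Dec (SupportsEdge v i j c)
  supportsEdge? v i j c =
    (c · v i ≟ℚ c · v j) ×-dec (all? λ k → ¬? (k ≟ i) →-dec ¬? (k ≟ j) →-dec (c · v k <? c · v i))

  blocksEdge? : ∀ {d n} (v : Fin n → Point d) i j α → Dec (BlocksEdge v i j α)
  blocksEdge? v i j α =
    ((sum α ≟ℚ 0ℚ) ×-dec (all? λ m → lincomb α v m ≟ℚ 0ℚ)) ×-dec
    (all? λ k → ¬? (k ≟ i) →-dec ¬? (k ≟ j) →-dec (0ℚ ≤? α k)) ×-dec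
    (any? λ k → ¬? (k ≟ i) ×-dec ¬? (k ≟ j) ×-dec (0ℚ <? α k))

  generatesDirections? : ∀ {d n} (v : Fin n → Point d) β → Dec (GeneratesDirections v β)
  generatesDirections? v β =
    all? λ m → (sum (β m) ≟ℚ 0ℚ) ×-dec (all? λ m′ → lincomb (β m) v m′ ≟ℚ basisVector m m′)

  endpoints : ∀ {n} {A : Set} → Fin n × Fin n × A → Fin n × Fin n
  endpoints (i , j , _) = i , j

  record Certificate (d n : ℕ) : Set where
    field
      vertices         : Vec (Vec ℚ d) n
      exposers         : Vec (Vec ℚ d) n
      unitCombinations : Vec (Vec ℚ n) d
      edges            : List (Fin n × Fin n × Vec ℚ d)
      nonEdges         : List (Fin n × Fin n × Vec ℚ n)

    vertex : Fin n → Point d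
    vertex i = lookup (lookup vertices i)

    exposer : Fin n → Point d
    exposer i = lookup (lookup exposers i)

    edgePairs : List (Fin n × Fin n)
    edgePairs = map endpoints edges

    nonEdgePairs : List (Fin n × Fin n)
    nonEdgePairs = map endpoints nonEdges

    Valid : Set
    Valid = (∀ i → Exposes vertex i (exposer i))
          × GeneratesDirections vertex (lookup ∘ lookup unitCombinations)
          × All (λ (i , j , c) → toℕ i ℕ.< toℕ j × SupportsEdge vertex i j (lookup c)) edges
          × All (λ (i , j , α) → BlocksEdge vertex i j (lookup α)) nonEdges
          × Unique edgePairs
          × (∀ i j → toℕ i ℕ.< toℕ j → (i , j) ∈ edgePairs ⊎ (i , j) ∈ nonEdgePairs)

    valid? : Dec Valid
    valid? =
      (all? λ i → exposes? vertex i (exposer i)) ×-dec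
      generatesDirections? vertex (lookup ∘ lookup unitCombinations) ×-dec
      All.all? (λ (i , j , c) → (toℕ i ℕ.<? toℕ j) ×-dec supportsEdge? vertex i j (lookup c)) edges ×-dec
      All.all? (λ (i , j , α) → blocksEdge? vertex i j (lookup α)) nonEdges ×-dec
      unique? _≟²_ edgePairs ×-dec
      (all? λ i → all? λ j → (toℕ i ℕ.<? toℕ j) →-dec
         (_∈?_ _≟²_ (i , j) edgePairs ⊎-dec _∈?_ _≟²_ (i , j) nonEdgePairs))
      where
      _≟²_ = ≡-dec _≟_ _≟_

    certified-isPolytope : Valid → IsPolytope d n vertex
    certified-isPolytope (exposes , generates , _) =
      (λ i → exposer i , exposes i) , generatesDirections⇒IsFullDim generates

    certified-hasEdgeCount : Valid → HasEdgeCount vertex (length edges)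
    certified-hasEdgeCount (_ , _ , supports , blocks , unique , complete) =
      edgePairs , unique , length-map endpoints edges , λ i j → mk⇔ (listed⇒edge i j) (edge⇒listed i j)
      where
      listed⇒edge : ∀ i j → (i , j) ∈ edgePairs → toℕ i ℕ.< toℕ j × IsEdge vertex i j
      listed⇒edge i j i,j∈ with ∈-map⁻ endpoints i,j∈
      ... | (i , j , c) , e∈ , refl with All.lookup supports e∈
      ...   | i<j , s = i<j , <⇒≢ i<j , lookup c , s
      edge⇒listed : ∀ i j → toℕ i ℕ.< toℕ j × IsEdge vertex i j → (i , j) ∈ edgePairs
      edge⇒listed i j (i<j , edge) with complete i j i<j
      ... | inj₁ i,j∈ = i,j∈
      ... | inj₂ i,j∈ with ∈-map⁻ endpoints i,j∈
      ...   | (i , j , α) , e∈ , refl = ⊥-elim (blocksEdge⇒¬IsEdge (All.lookup blocks e∈) edge)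

  -- Pyramids

  apex : ∀ {d} → Point (suc d)
  apex = 1ℚ ∷ λ _ → 0ℚ

  lift : ∀ {d} → Point d → Point (suc d)
  lift p = 0ℚ ∷ p

  pyramid : ∀ {d n} → (Fin n → Point d) → Fin (suc n) → Point (suc d)
  pyramid v = apex ∷ (lift ∘ v)

  ·-apex : ∀ {d} (C : Point (suc d)) → C · apex ≡ C zero
  ·-apex C =
    trans (cong₂ _+_ (*-identityʳ (C zero)) (·-zeroʳ (tail C) λ _ → refl)) (+-identityʳ (C zero))

  ·-lift : ∀ {d} (C : Point (suc d)) (p : Point d) → C · lift p ≡ tail C · p
  ·-lift C p = trans (cong (_+ (tail C · p)) (*-zeroʳ (C zero))) (+-identityˡ (tail C · p))

  p-1<p : ∀ p → p - 1ℚ < p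
  p-1<p p = subst (p - 1ℚ <_) (+-identityʳ p) (+-monoʳ-< p (negative⁻¹ (- 1ℚ)))

  module _ {d n : ℕ} (v : Fin n → Point d) where

    lowerApex : Fin n → Point d → Point (suc d)
    lowerApex i c = (c · v i - 1ℚ) ∷ c

    lowerApex-base : ∀ i c k → lowerApex i c · pyramid v (suc k) ≡ c · v k
    lowerApex-base i c k = ·-lift (lowerApex i c) (v k)

    lowerApex-apex : ∀ i c → lowerApex i c · pyramid v zero < lowerApex i c · pyramid v (suc i)
    lowerApex-apex i c =
      subst₂ _<_ (sym (·-apex (lowerApex i c))) (sym (lowerApex-base i c i)) (p-1<p (c · v i))

    lowerApex-below : ∀ i c {k} → c · v k < c · v i →
                      lowerApex i c · pyramid v (suc k) < lowerApex i c · pyramid v (suc i)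
    lowerApex-below i c {k} = subst₂ _<_ (sym (lowerApex-base i c k)) (sym (lowerApex-base i c i))

    pyramid-isVertexList : IsVertexList v → IsVertexList (pyramid v)
    pyramid-isVertexList exposed zero = apex , apex-exposed
      where
      apex-exposed : ∀ k → k ≢ zero → apex · pyramid v k < apex {d} · apex
      apex-exposed zero    0≢0 = ⊥-elim (0≢0 refl)
      apex-exposed (suc k) _   = subst₂ _<_ (sym (trans (·-lift apex (v k)) (·-zeroˡ (v k) λ _ → refl)))
                                             (sym (·-apex (apex {d}))) (positive⁻¹ 1ℚ)
    pyramid-isVertexList exposed (suc i) =
      lowerApex i c , λ { zero _ → lowerApex-apex i c
                        ; (suc k) k≢i → lowerApex-below i c (proj₂ (exposed i) k (k≢i ∘ cong suc)) }
      where c = proj₁ (exposed i)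

    pyramid-isFullDim : IsFullDim v → Fin n → IsFullDim (pyramid v)
    pyramid-isFullDim fullDim z C _ C-const = C≗0
      where
      onBase : ∀ k → tail C · v k ≡ C zero
      onBase k = begin
        tail C · v k          ≡⟨ ·-lift C (v k) ⟨
        C · pyramid v (suc k) ≡⟨ trans (C-const (suc k)) (sym (C-const zero)) ⟩
        C · apex              ≡⟨ ·-apex C ⟩
        C zero                ∎
        where open ≡-Reasoning
      tailC≗0 : ∀ m → tail C m ≡ 0ℚ
      tailC≗0 = fullDim (tail C) z (λ k → trans (onBase k) (sym (onBase z)))
      C≗0 : ∀ m → C m ≡ 0ℚ
      C≗0 zero    = trans (sym (onBase z)) (·-zeroˡ (v z) tailC≗0)
      C≗0 (suc m) = tailC≗0 m

    pyramid-isPolytope : IsPolytope d n v → Fin n → IsPolytope (suc d) (suc n) (pyramid v)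
    pyramid-isPolytope (exposed , fullDim) z = pyramid-isVertexList exposed , pyramid-isFullDim fullDim z

    pyramid-apexEdge : IsVertexList v → ∀ j → IsEdge (pyramid v) zero (suc j)
    pyramid-apexEdge exposed j = (λ ()) , C , trans (·-apex C) (sym (·-lift C (v j))) , below
      where
      c = proj₁ (exposed j)
      C = (c · v j) ∷ c
      below : ∀ k → k ≢ zero → k ≢ suc j → C · pyramid v k < C · apex
      below zero    0≢0 _   = ⊥-elim (0≢0 refl)
      below (suc k) _   k≢j = subst₂ _<_ (sym (·-lift C (v k))) (sym (·-apex C))
                                         (proj₂ (exposed j) k (k≢j ∘ cong suc))

    pyramid-baseEdge : ∀ {i j} → IsEdge (pyramid v) (suc i) (suc j) ⇔ IsEdge v i j
    pyramid-baseEdge {i} {j} = mk⇔ restrict extend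
      where
      restrict : IsEdge (pyramid v) (suc i) (suc j) → IsEdge v i j
      restrict (i≢j , C , eq , below) =
        i≢j ∘ cong suc , tail C ,
        trans (sym (·-lift C (v i))) (trans eq (·-lift C (v j))) ,
        λ k k≢i k≢j → subst₂ _<_ (·-lift C (v k)) (·-lift C (v i))
                        (below (suc k) (k≢i ∘ suc-injective) (k≢j ∘ suc-injective))
      extend : IsEdge v i j → IsEdge (pyramid v) (suc i) (suc j)
      extend (i≢j , c , eq , below) =
        i≢j ∘ suc-injective , lowerApex i c ,
        trans (lowerApex-base i c i) (trans eq (sym (lowerApex-base i c j))) ,
        λ { zero _ _ → lowerApex-apex i c
          ; (suc k) k≢i k≢j → lowerApex-below i c (below k (k≢i ∘ cong suc) (k≢j ∘ cong suc)) }

    pyramid-hasEdgeCount : ∀ {e} → IsVertexList v → HasEdgeCount v e → HasEdgeCount (pyramid v) (n ℕ.+ e)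
    pyramid-hasEdgeCount {e} exposed (es , unique , length-es , listed⇔edge) =
      apexEdges ++ baseEdges , unique′ , length′ , λ i j → mk⇔ (listed⇒edge i j) (edge⇒listed i j)
      where
      toApex : Fin n → Fin (suc n) × Fin (suc n)
      toApex j = zero , suc j
      liftPair : Fin n × Fin n → Fin (suc n) × Fin (suc n)
      liftPair = Product.map suc suc
      apexEdges = map toApex (allFin n)
      baseEdges = map liftPair es

      toApex-injective : ∀ {j j′} → toApex j ≡ toApex j′ → j ≡ j′
      toApex-injective refl = refl
      liftPair-injective : ∀ {p q} → liftPair p ≡ liftPair q → p ≡ q
      liftPair-injective {_ , _} {_ , _} refl = refl

      unique′ : Unique (apexEdges ++ baseEdges)
      unique′ = ++⁺ (map⁺ toApex-injective (allFin⁺ n)) (map⁺ liftPair-injective unique) disjoint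
        where
        disjoint : ∀ {p} → ¬ (p ∈ apexEdges × p ∈ baseEdges)
        disjoint (p∈apex , p∈base) with ∈-map⁻ toApex p∈apex | ∈-map⁻ liftPair p∈base
        ... | _ , _ , refl | _ , _ , ()

      length′ : length (apexEdges ++ baseEdges) ≡ n ℕ.+ e
      length′ = trans (length-++ apexEdges)
                      (cong₂ ℕ._+_ (trans (length-map toApex (allFin n)) (length-tabulate (λ j → j)))
                                   (trans (length-map liftPair es) length-es))

      listed⇒edge : ∀ i j → (i , j) ∈ apexEdges ++ baseEdges → toℕ i ℕ.< toℕ j × IsEdge (pyramid v) i j
      listed⇒edge i j i,j∈ with ∈-++⁻ apexEdges i,j∈
      ... | inj₁ i,j∈apex with ∈-map⁻ toApex i,j∈apex
      ...   | k , _ , refl = ℕ.s≤s ℕ.z≤n , pyramid-apexEdge exposed k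
      listed⇒edge i j i,j∈ | inj₂ i,j∈base with ∈-map⁻ liftPair i,j∈base
      ...   | (a , b) , a,b∈ , refl with Equivalence.to (listed⇔edge a b) a,b∈
      ...     | a<b , edge = ℕ.s≤s a<b , Equivalence.from pyramid-baseEdge edge

      edge⇒listed : ∀ i j → toℕ i ℕ.< toℕ j × IsEdge (pyramid v) i j → (i , j) ∈ apexEdges ++ baseEdges
      edge⇒listed zero    (suc j) _ = ∈-++⁺ˡ (∈-map⁺ toApex (∈-allFin j))
      edge⇒listed (suc i) (suc j) (ℕ.s≤s i<j , edge) =
        ∈-++⁺ʳ apexEdges (∈-map⁺ liftPair
          (Equivalence.from (listed⇔edge i j) (i<j , Equivalence.to pyramid-baseEdge edge)))

module SmallPolytopes where

  open Geometry using (Certificate)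
  open import Data.Fin using (Fin)
  open import Agda.Builtin.FromNat using (Number; fromNat)
  open import Agda.Builtin.FromNeg using (fromNeg)
  open import Data.Vec using (_∷_; [])
  open import Data.List using (_∷_; [])
  open import Data.Product using (_,_)
  open import Data.Rational using (_/_)
  open import Data.Unit using (⊤; tt)
  open import Relation.Nullary.Decidable using (from-yes)
  import Data.Fin.Literals as Fin
  import Data.Integer.Literals as ℤ
  import Data.Nat.Literals as ℕ
  import Data.Rational.Literals as ℚ

  -- Literals are read through fromNat / fromNeg, which must be in scope; the instances below
  -- supply the Number structures and their (trivial) side conditions.
  instance
    trivial : ⊤
    trivial = tt
    ℕ-number = ℕ.number
    ℤ-number = ℤ.number
    ℤ-negative = ℤ.negative
    ℚ-number = ℚ.number
    ℚ-negative = ℚ.negative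
    Fin-number : ∀ {n} → Number (Fin n)
    Fin-number {n} = Fin.number n

  cyclic-4-7 : Certificate 4 7
  cyclic-4-7 = record
    { vertices =
        (-3 ∷ 9 ∷ -27 ∷ 81 ∷ []) ∷
        (-2 ∷ 4 ∷  -8 ∷ 16 ∷ []) ∷
        (-1 ∷ 1 ∷  -1 ∷  1 ∷ []) ∷
        ( 0 ∷ 0 ∷   0 ∷  0 ∷ []) ∷
        ( 1 ∷ 1 ∷   1 ∷  1 ∷ []) ∷
        ( 2 ∷ 4 ∷   8 ∷ 16 ∷ []) ∷
        ( 3 ∷ 9 ∷  27 ∷ 81 ∷ []) ∷
        []
    ; exposers =
        (  8 ∷ -24 ∷ -12 ∷  0 ∷ []) ∷
        (-25 ∷  14 ∷  -9 ∷ -6 ∷ []) ∷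
        (-56 ∷ -14 ∷   4 ∷ -4 ∷ []) ∷
        (  0 ∷ -40 ∷   0 ∷ -4 ∷ []) ∷
        ( 56 ∷ -14 ∷  -4 ∷ -4 ∷ []) ∷
        ( 25 ∷  14 ∷   9 ∷ -6 ∷ []) ∷
        ( -8 ∷ -24 ∷  12 ∷  0 ∷ []) ∷
        []
    ; unitCombinations =
        (-1 / 12 ∷  1 / 2 ∷ -3 / 2 ∷  5 / 6 ∷   1 / 4 ∷ 0 ∷ 0 ∷ []) ∷
        (-1 / 24 ∷  1 / 6 ∷  1 / 4 ∷ -5 / 6 ∷ 11 / 24 ∷ 0 ∷ 0 ∷ []) ∷
        ( 1 / 12 ∷ -1 / 2 ∷      1 ∷ -5 / 6 ∷   1 / 4 ∷ 0 ∷ 0 ∷ []) ∷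
        ( 1 / 24 ∷ -1 / 6 ∷  1 / 4 ∷ -1 / 6 ∷  1 / 24 ∷ 0 ∷ 0 ∷ []) ∷
        []
    ; edges =
        (0 , 1 , -19 ∷   1 ∷  -9 ∷ -3 ∷ []) ∷
        (0 , 2 , -42 ∷ -27 ∷  -2 ∷  1 ∷ []) ∷
        (0 , 3 ,   0 ∷ -30 ∷ -10 ∷  0 ∷ []) ∷
        (0 , 4 ,  50 ∷ -10 ∷ -10 ∷  0 ∷ []) ∷
        (0 , 5 ,  35 ∷  13 ∷  -5 ∷ -1 ∷ []) ∷
        (0 , 6 ,   0 ∷ -19 ∷   0 ∷  3 ∷ []) ∷
        (1 , 2 , -39 ∷  -5 ∷  -3 ∷ -3 ∷ []) ∷
        (1 , 3 ,   2 ∷ -11 ∷ -12 ∷ -3 ∷ []) ∷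
        (1 , 4 ,  16 ∷  12 ∷  -8 ∷ -4 ∷ []) ∷
        (1 , 5 ,   0 ∷  32 ∷   0 ∷ -4 ∷ []) ∷
        (1 , 6 , -35 ∷  13 ∷   5 ∷ -1 ∷ []) ∷
        (2 , 3 , -21 ∷ -19 ∷  -1 ∷ -3 ∷ []) ∷
        (2 , 4 ,   0 ∷   7 ∷   0 ∷ -3 ∷ []) ∷
        (2 , 5 , -16 ∷  12 ∷   8 ∷ -4 ∷ []) ∷
        (2 , 6 , -50 ∷ -10 ∷  10 ∷  0 ∷ []) ∷
        (3 , 4 ,  21 ∷ -19 ∷   1 ∷ -3 ∷ []) ∷
        (3 , 5 ,  -2 ∷ -11 ∷  12 ∷ -3 ∷ []) ∷
        (3 , 6 ,   0 ∷ -30 ∷  10 ∷  0 ∷ []) ∷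
        (4 , 5 ,  39 ∷  -5 ∷   3 ∷ -3 ∷ []) ∷
        (4 , 6 ,  42 ∷ -27 ∷   2 ∷  1 ∷ []) ∷
        (5 , 6 ,  19 ∷   1 ∷   9 ∷ -3 ∷ []) ∷
        []
    ; nonEdges = []
    }

  fourPolytope-20-edges : Certificate 4 7
  fourPolytope-20-edges = record
    { vertices =
        (3 ∷  -6 ∷ 4 ∷  5 ∷ []) ∷
        (9 ∷ -12 ∷ 6 ∷ 12 ∷ []) ∷
        (3 ∷   0 ∷ 0 ∷  0 ∷ []) ∷
        (0 ∷   3 ∷ 0 ∷  0 ∷ []) ∷
        (0 ∷   0 ∷ 3 ∷  0 ∷ []) ∷
        (0 ∷   0 ∷ 0 ∷  3 ∷ []) ∷
        (0 ∷   0 ∷ 0 ∷  0 ∷ []) ∷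
        []
    ; exposers =
        (-5 ∷ -12 ∷ -2 ∷  -8 ∷ []) ∷
        (-2 ∷  -2 ∷ -1 ∷   2 ∷ []) ∷
        ( 3 ∷  -8 ∷ -4 ∷ -10 ∷ []) ∷
        ( 0 ∷   5 ∷  2 ∷   3 ∷ []) ∷
        (-4 ∷  -2 ∷  7 ∷  -4 ∷ []) ∷
        (-7 ∷   0 ∷ -2 ∷   6 ∷ []) ∷
        (-5 ∷ -13 ∷ -8 ∷  -9 ∷ []) ∷
        []
    ; unitCombinations =
        (-1 / 2 ∷ 5 / 24 ∷ 5 / 24 ∷ -1 / 6 ∷  1 / 4 ∷ 0 ∷ 0 ∷ []) ∷
        (-1 / 2 ∷ 5 / 24 ∷ -1 / 8 ∷  1 / 6 ∷  1 / 4 ∷ 0 ∷ 0 ∷ []) ∷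
        (-1 / 2 ∷ 5 / 24 ∷ -1 / 8 ∷ -1 / 6 ∷ 7 / 12 ∷ 0 ∷ 0 ∷ []) ∷
        (     0 ∷ 1 / 12 ∷ -1 / 4 ∷  1 / 3 ∷ -1 / 6 ∷ 0 ∷ 0 ∷ []) ∷
        []
    ; edges =
        (0 , 1 , -3 ∷  -6 ∷ -2 ∷  -2 ∷ []) ∷
        (0 , 2 ,  1 ∷  -9 ∷ -1 ∷ -10 ∷ []) ∷
        (0 , 4 , -3 ∷  -6 ∷  3 ∷  -6 ∷ []) ∷
        (0 , 5 , -6 ∷  -3 ∷ -1 ∷   2 ∷ []) ∷
        (0 , 6 , -4 ∷ -12 ∷ -5 ∷  -8 ∷ []) ∷
        (1 , 2 ,  3 ∷  -3 ∷ -3 ∷  -3 ∷ []) ∷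
        (1 , 3 ,  1 ∷   5 ∷  3 ∷   4 ∷ []) ∷
        (1 , 4 , -1 ∷   4 ∷  7 ∷   3 ∷ []) ∷
        (1 , 5 , -4 ∷   1 ∷ -1 ∷   6 ∷ []) ∷
        (1 , 6 , -2 ∷  -7 ∷ -7 ∷  -2 ∷ []) ∷
        (2 , 3 ,  2 ∷   2 ∷ -1 ∷   0 ∷ []) ∷
        (2 , 4 ,  2 ∷  -5 ∷  2 ∷  -9 ∷ []) ∷
        (2 , 5 ,  1 ∷   0 ∷ -4 ∷   1 ∷ []) ∷
        (2 , 6 ,  0 ∷  -9 ∷ -5 ∷  -9 ∷ []) ∷
        (3 , 4 , -1 ∷   4 ∷  4 ∷   2 ∷ []) ∷
        (3 , 5 , -1 ∷   4 ∷  1 ∷   4 ∷ []) ∷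
        (3 , 6 , -1 ∷   0 ∷ -1 ∷  -1 ∷ []) ∷
        (4 , 5 , -6 ∷   3 ∷  5 ∷   5 ∷ []) ∷
        (4 , 6 , -3 ∷  -6 ∷  0 ∷  -7 ∷ []) ∷
        (5 , 6 , -5 ∷  -5 ∷ -6 ∷   0 ∷ []) ∷
        []
    ; nonEdges =
        (0 , 3 , -3 / 2 ∷ 3 / 8 ∷ 3 / 8 ∷ -3 / 2 ∷ 5 / 4 ∷ 1 ∷ 0 ∷ []) ∷
        []
    }

  fourPolytope-19-edges : Certificate 4 7
  fourPolytope-19-edges = record
    { vertices =
        (-1 ∷ -1 ∷ -1 ∷  0 ∷ []) ∷
        (-2 ∷  0 ∷ -1 ∷  1 ∷ []) ∷
        ( 2 ∷  0 ∷ -1 ∷  1 ∷ []) ∷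
        ( 1 ∷ -2 ∷  0 ∷  2 ∷ []) ∷
        ( 0 ∷ -1 ∷ -2 ∷  2 ∷ []) ∷
        ( 2 ∷ -1 ∷  1 ∷  2 ∷ []) ∷
        (-1 ∷  0 ∷  1 ∷ -1 ∷ []) ∷
        []
    ; exposers =
        (  0 ∷ -34 ∷  -7 ∷ -18 ∷ []) ∷
        (-24 ∷ -12 ∷  15 ∷  19 ∷ []) ∷
        ( 24 ∷ -24 ∷ -11 ∷ -27 ∷ []) ∷
        (  0 ∷ -48 ∷   8 ∷  -8 ∷ []) ∷
        (  0 ∷ -14 ∷ -10 ∷   8 ∷ []) ∷
        (  0 ∷  -8 ∷  13 ∷  10 ∷ []) ∷
        (  0 ∷ -28 ∷  16 ∷ -16 ∷ []) ∷
        []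
    ; unitCombinations =
        (     0 ∷ -1 / 4 ∷   1 / 4 ∷      0 ∷      0 ∷ 0 ∷ 0 ∷ []) ∷
        (-2 / 5 ∷ 9 / 20 ∷  7 / 20 ∷ -1 / 5 ∷ -1 / 5 ∷ 0 ∷ 0 ∷ []) ∷
        (-1 / 5 ∷ 7 / 20 ∷  1 / 20 ∷  2 / 5 ∷ -3 / 5 ∷ 0 ∷ 0 ∷ []) ∷
        (-3 / 5 ∷ 3 / 10 ∷ -1 / 10 ∷  1 / 5 ∷  1 / 5 ∷ 0 ∷ 0 ∷ []) ∷
        []
    ; edges =
        (0 , 1 , -13 ∷ -14 ∷   1 ∷   1 ∷ []) ∷
        (0 , 2 ,  13 ∷ -18 ∷ -11 ∷ -21 ∷ []) ∷
        (0 , 3 ,   0 ∷ -36 ∷  -4 ∷ -16 ∷ []) ∷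
        (0 , 4 ,   0 ∷ -15 ∷ -10 ∷  -5 ∷ []) ∷
        (0 , 6 ,   0 ∷ -19 ∷   3 ∷ -13 ∷ []) ∷
        (1 , 2 ,   0 ∷   6 ∷  -2 ∷   0 ∷ []) ∷
        (1 , 3 , -24 ∷ -18 ∷  17 ∷  19 ∷ []) ∷
        (1 , 4 ,  -8 ∷  -4 ∷  -1 ∷  11 ∷ []) ∷
        (1 , 5 , -11 ∷   2 ∷  14 ∷  18 ∷ []) ∷
        (1 , 6 , -16 ∷  -8 ∷  16 ∷   8 ∷ []) ∷
        (2 , 3 ,  24 ∷ -30 ∷  -9 ∷ -27 ∷ []) ∷
        (2 , 4 ,   8 ∷  -8 ∷ -11 ∷  -3 ∷ []) ∷
        (2 , 5 ,  11 ∷  -6 ∷   0 ∷  -6 ∷ []) ∷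
        (2 , 6 ,  16 ∷ -16 ∷   0 ∷ -24 ∷ []) ∷
        (3 , 4 ,   0 ∷ -16 ∷  -8 ∷   8 ∷ []) ∷
        (3 , 5 ,   0 ∷ -12 ∷  12 ∷   8 ∷ []) ∷
        (3 , 6 ,   0 ∷ -32 ∷  16 ∷ -16 ∷ []) ∷
        (4 , 5 ,   0 ∷   1 ∷   0 ∷  13 ∷ []) ∷
        (5 , 6 ,   0 ∷  -9 ∷  13 ∷  -3 ∷ []) ∷
        []
    ; nonEdges =
        (0 , 5 ,     -6 ∷   3 / 4 ∷   9 / 4 ∷      6 ∷       0 ∷ -6 ∷  3 ∷ []) ∷
        (4 , 6 , 24 / 5 ∷ 51 / 10 ∷ 33 / 10 ∷ 12 / 5 ∷ -48 / 5 ∷  0 ∷ -6 ∷ []) ∷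
        []
    }

  octahedron : Certificate 3 6
  octahedron = record
    { vertices =
        ( 1 ∷  0 ∷  0 ∷ []) ∷
        (-1 ∷  0 ∷  0 ∷ []) ∷
        ( 0 ∷  1 ∷  0 ∷ []) ∷
        ( 0 ∷ -1 ∷  0 ∷ []) ∷
        ( 0 ∷  0 ∷  1 ∷ []) ∷
        ( 0 ∷  0 ∷ -1 ∷ []) ∷
        []
    ; exposers =
        ( 4 ∷  0 ∷  0 ∷ []) ∷
        (-4 ∷  0 ∷  0 ∷ []) ∷
        ( 0 ∷  4 ∷  0 ∷ []) ∷
        ( 0 ∷ -4 ∷  0 ∷ []) ∷
        ( 0 ∷  0 ∷  4 ∷ []) ∷
        ( 0 ∷  0 ∷ -4 ∷ []) ∷
        []
    ; unitCombinations =
        ( 1 / 2 ∷ -1 / 2 ∷ 0 ∷ 0 ∷ 0 ∷ 0 ∷ []) ∷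
        (-1 / 2 ∷ -1 / 2 ∷ 1 ∷ 0 ∷ 0 ∷ 0 ∷ []) ∷
        (-1 / 2 ∷ -1 / 2 ∷ 0 ∷ 0 ∷ 1 ∷ 0 ∷ []) ∷
        []
    ; edges =
        (0 , 2 ,  2 ∷  2 ∷  0 ∷ []) ∷
        (0 , 3 ,  2 ∷ -2 ∷  0 ∷ []) ∷
        (0 , 4 ,  2 ∷  0 ∷  2 ∷ []) ∷
        (0 , 5 ,  2 ∷  0 ∷ -2 ∷ []) ∷
        (1 , 2 , -2 ∷  2 ∷  0 ∷ []) ∷
        (1 , 3 , -2 ∷ -2 ∷  0 ∷ []) ∷
        (1 , 4 , -2 ∷  0 ∷  2 ∷ []) ∷
        (1 , 5 , -2 ∷  0 ∷ -2 ∷ []) ∷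
        (2 , 4 ,  0 ∷  2 ∷  2 ∷ []) ∷
        (2 , 5 ,  0 ∷  2 ∷ -2 ∷ []) ∷
        (3 , 4 ,  0 ∷ -2 ∷  2 ∷ []) ∷
        (3 , 5 ,  0 ∷ -2 ∷ -2 ∷ []) ∷
        []
    ; nonEdges =
        (0 , 1 , -1 ∷ -1 ∷  0 ∷  0 ∷  1 ∷  1 ∷ []) ∷
        (2 , 3 ,  6 ∷  6 ∷ -6 ∷ -6 ∷  0 ∷  0 ∷ []) ∷
        (4 , 5 ,  6 ∷  6 ∷  0 ∷  0 ∷ -6 ∷ -6 ∷ []) ∷
        []
    }

  stackedSquarePyramid : Certificate 3 6
  stackedSquarePyramid = record
    { vertices =
        (0 ∷ 0 ∷ 0 ∷ []) ∷
        (6 ∷ 0 ∷ 0 ∷ []) ∷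
        (6 ∷ 6 ∷ 0 ∷ []) ∷
        (0 ∷ 6 ∷ 0 ∷ []) ∷
        (3 ∷ 3 ∷ 6 ∷ []) ∷
        (3 ∷ 0 ∷ 3 ∷ []) ∷
        []
    ; exposers =
        (-3 ∷ -2 ∷ 1 ∷ []) ∷
        ( 3 ∷ -2 ∷ 1 ∷ []) ∷
        ( 2 ∷  2 ∷ 1 ∷ []) ∷
        (-2 ∷  2 ∷ 1 ∷ []) ∷
        ( 0 ∷  0 ∷ 5 ∷ []) ∷
        ( 0 ∷ -3 ∷ 2 ∷ []) ∷
        []
    ; unitCombinations =
        ( -1 / 6 ∷  1 / 6 ∷       0 ∷ 0 ∷     0 ∷ 0 ∷ []) ∷
        (      0 ∷ -1 / 6 ∷   1 / 6 ∷ 0 ∷     0 ∷ 0 ∷ []) ∷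
        (-1 / 12 ∷      0 ∷ -1 / 12 ∷ 0 ∷ 1 / 6 ∷ 0 ∷ []) ∷
        []
    ; edges =
        (0 , 1 ,  0 ∷ -1 ∷ -1 ∷ []) ∷
        (0 , 3 , -2 ∷  0 ∷  0 ∷ []) ∷
        (0 , 4 , -3 ∷ -1 ∷  2 ∷ []) ∷
        (0 , 5 , -1 ∷ -2 ∷  1 ∷ []) ∷
        (1 , 2 ,  2 ∷  0 ∷  0 ∷ []) ∷
        (1 , 4 ,  3 ∷ -1 ∷  2 ∷ []) ∷
        (1 , 5 ,  1 ∷ -2 ∷  1 ∷ []) ∷
        (2 , 3 ,  0 ∷  2 ∷  0 ∷ []) ∷
        (2 , 4 ,  2 ∷  2 ∷  2 ∷ []) ∷
        (3 , 4 , -2 ∷  2 ∷  2 ∷ []) ∷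
        (4 , 5 ,  0 ∷ -2 ∷  2 ∷ []) ∷
        []
    ; nonEdges =
        (0 , 2 ,    -1 ∷  1 ∷     -1 ∷  1 ∷ 0 ∷  0 ∷ []) ∷
        (1 , 3 ,     6 ∷ -6 ∷      6 ∷ -6 ∷ 0 ∷  0 ∷ []) ∷
        (2 , 5 , 3 / 2 ∷  3 ∷ -3 / 2 ∷  0 ∷ 3 ∷ -6 ∷ []) ∷
        (3 , 5 , 9 / 2 ∷  0 ∷  3 / 2 ∷ -3 ∷ 3 ∷ -6 ∷ []) ∷
        []
    }

  pentagonalPyramid : Certificate 3 6
  pentagonalPyramid = record
    { vertices =
        ( 0 ∷ 0 ∷ 0 ∷ []) ∷
        ( 2 ∷ 0 ∷ 0 ∷ []) ∷
        ( 3 ∷ 2 ∷ 0 ∷ []) ∷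
        ( 1 ∷ 3 ∷ 0 ∷ []) ∷
        (-1 ∷ 2 ∷ 0 ∷ []) ∷
        ( 1 ∷ 1 ∷ 1 ∷ []) ∷
        []
    ; exposers =
        (-2 ∷ -2 ∷  3 ∷ []) ∷
        ( 2 ∷ -2 ∷  3 ∷ []) ∷
        ( 3 ∷  1 ∷  6 ∷ []) ∷
        ( 0 ∷  4 ∷  7 ∷ []) ∷
        (-3 ∷  1 ∷  6 ∷ []) ∷
        ( 0 ∷  1 ∷ 15 ∷ []) ∷
        []
    ; unitCombinations =
        (-1 / 2 ∷  1 / 2 ∷      0 ∷ 0 ∷ 0 ∷ 0 ∷ []) ∷
        ( 1 / 4 ∷ -3 / 4 ∷  1 / 2 ∷ 0 ∷ 0 ∷ 0 ∷ []) ∷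
        (-3 / 4 ∷  1 / 4 ∷ -1 / 2 ∷ 0 ∷ 0 ∷ 1 ∷ []) ∷
        []
    ; edges =
        (0 , 1 ,  0 ∷ -1 ∷ 0 ∷ []) ∷
        (0 , 4 , -2 ∷ -1 ∷ 2 ∷ []) ∷
        (0 , 5 , -2 ∷ -2 ∷ 4 ∷ []) ∷
        (1 , 2 ,  2 ∷ -1 ∷ 2 ∷ []) ∷
        (1 , 5 ,  2 ∷ -2 ∷ 4 ∷ []) ∷
        (2 , 3 ,  1 ∷  2 ∷ 3 ∷ []) ∷
        (2 , 5 ,  3 ∷  1 ∷ 7 ∷ []) ∷
        (3 , 4 , -1 ∷  2 ∷ 3 ∷ []) ∷
        (3 , 5 ,  0 ∷  4 ∷ 8 ∷ []) ∷
        (4 , 5 , -3 ∷  1 ∷ 7 ∷ []) ∷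
        []
    ; nonEdges =
        (0 , 2 ,     -2 ∷       2 ∷     -1 ∷  0 ∷  1 ∷ 0 ∷ []) ∷
        (0 , 3 , -9 / 2 ∷   3 / 2 ∷      3 ∷ -6 ∷  6 ∷ 0 ∷ []) ∷
        (1 , 3 , 15 / 2 ∷ -21 / 2 ∷      9 ∷ -6 ∷  0 ∷ 0 ∷ []) ∷
        (1 , 4 ,     12 ∷     -12 ∷      6 ∷  0 ∷ -6 ∷ 0 ∷ []) ∷
        (2 , 4 ,  1 / 4 ∷   5 / 4 ∷ -5 / 2 ∷  3 ∷ -2 ∷ 0 ∷ []) ∷
        []
    }

  triangularPrism : Certificate 3 6
  triangularPrism = record
    { vertices =
        (0 ∷ 0 ∷ 0 ∷ []) ∷
        (1 ∷ 0 ∷ 0 ∷ []) ∷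
        (0 ∷ 1 ∷ 0 ∷ []) ∷
        (0 ∷ 0 ∷ 1 ∷ []) ∷
        (1 ∷ 0 ∷ 1 ∷ []) ∷
        (0 ∷ 1 ∷ 1 ∷ []) ∷
        []
    ; exposers =
        (-1 ∷ -1 ∷ -1 ∷ []) ∷
        ( 1 ∷  0 ∷ -1 ∷ []) ∷
        ( 0 ∷  1 ∷ -1 ∷ []) ∷
        (-1 ∷ -1 ∷  1 ∷ []) ∷
        ( 1 ∷  0 ∷  1 ∷ []) ∷
        ( 0 ∷  1 ∷  1 ∷ []) ∷
        []
    ; unitCombinations =
        (-1 ∷ 1 ∷ 0 ∷ 0 ∷ 0 ∷ 0 ∷ []) ∷
        (-1 ∷ 0 ∷ 1 ∷ 0 ∷ 0 ∷ 0 ∷ []) ∷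
        (-1 ∷ 0 ∷ 0 ∷ 1 ∷ 0 ∷ 0 ∷ []) ∷
        []
    ; edges =
        (0 , 1 ,  0 ∷ -1 ∷ -1 ∷ []) ∷
        (0 , 2 , -1 ∷  0 ∷ -1 ∷ []) ∷
        (0 , 3 , -1 ∷ -1 ∷  0 ∷ []) ∷
        (1 , 2 ,  1 ∷  1 ∷ -1 ∷ []) ∷
        (1 , 4 ,  1 ∷  0 ∷  0 ∷ []) ∷
        (2 , 5 ,  0 ∷  1 ∷  0 ∷ []) ∷
        (3 , 4 ,  0 ∷ -1 ∷  1 ∷ []) ∷
        (3 , 5 , -1 ∷  0 ∷  1 ∷ []) ∷
        (4 , 5 ,  1 ∷  1 ∷  1 ∷ []) ∷
        []
    ; nonEdges =
        (0 , 4 , -6 ∷  6 ∷  0 ∷  6 ∷ -6 ∷  0 ∷ []) ∷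
        (0 , 5 , -6 ∷  0 ∷  6 ∷  6 ∷  0 ∷ -6 ∷ []) ∷
        (1 , 3 ,  1 ∷ -1 ∷  0 ∷ -1 ∷  1 ∷  0 ∷ []) ∷
        (1 , 5 ,  0 ∷ -1 ∷  1 ∷  0 ∷  1 ∷ -1 ∷ []) ∷
        (2 , 3 ,  1 ∷  0 ∷ -1 ∷ -1 ∷  0 ∷  1 ∷ []) ∷
        (2 , 4 ,  0 ∷  6 ∷ -6 ∷  0 ∷ -6 ∷  6 ∷ []) ∷
        []
    }

  cyclic-4-7-valid : Certificate.Valid cyclic-4-7
  cyclic-4-7-valid = from-yes (Certificate.valid? cyclic-4-7)

  fourPolytope-20-edges-valid : Certificate.Valid fourPolytope-20-edges
  fourPolytope-20-edges-valid = from-yes (Certificate.valid? fourPolytope-20-edges)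

  fourPolytope-19-edges-valid : Certificate.Valid fourPolytope-19-edges
  fourPolytope-19-edges-valid = from-yes (Certificate.valid? fourPolytope-19-edges)

  octahedron-valid : Certificate.Valid octahedron
  octahedron-valid = from-yes (Certificate.valid? octahedron)

  stackedSquarePyramid-valid : Certificate.Valid stackedSquarePyramid
  stackedSquarePyramid-valid = from-yes (Certificate.valid? stackedSquarePyramid)

  pentagonalPyramid-valid : Certificate.Valid pentagonalPyramid
  pentagonalPyramid-valid = from-yes (Certificate.valid? pentagonalPyramid)

  triangularPrism-valid : Certificate.Valid triangularPrism
  triangularPrism-valid = from-yes (Certificate.valid? triangularPrism)

open import Data.Nat using (_≤_; _≤′_; _+_; _*_; _/_; _∸_; s≤s; ≤′-refl; ≤′-step)
open import Data.Nat.Properties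
  using (+-assoc; +-comm; +-cancelʳ-≡; +-monoˡ-≤; m+[n∸m]≡n; m≤n+o⇒m∸n≤o; ≤⇒≤′)
open import Data.Nat.Combinatorics using (_C_; nC1≡n; nCk+nC[k+1]≡[n+1]C[k+1])
open import Data.Nat.DivMod using (m*n/n≡m)
open import Data.Nat.Solver using (module +-*-Solver)
open import Data.Fin using (Fin; zero; _↑ʳ_)
open import Data.List using (length)
open import Data.Product using (Σ; Σ-syntax; _×_; _,_)
open import Relation.Binary.PropositionalEquality
  using (_≡_; refl; sym; trans; cong; subst; module ≡-Reasoning)

open Geometry
open SmallPolytopes

-- Missing edges

[1+n]C2≡n+nC2 : ∀ n → suc n C 2 ≡ n + n C 2
[1+n]C2≡n+nC2 n = trans (sym (nCk+nC[k+1]≡[n+1]C[k+1] n 1)) (cong (_+ n C 2) (nC1≡n n))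

MissingEdges : ℕ → ℕ → Set
MissingEdges d m =
  Σ[ v ∈ (Fin (d + 3) → Point d) ] IsPolytope d (d + 3) v ×
  Σ[ e ∈ ℕ ] HasEdgeCount v e × e + m ≡ (d + 3) C 2

certified-missingEdges : ∀ {d m} (P : Certificate d (d + 3)) → Certificate.Valid P →
                         length (Certificate.edges P) + m ≡ (d + 3) C 2 → MissingEdges d m
certified-missingEdges P valid e+m≡ =
  vertex , certified-isPolytope valid , length edges , certified-hasEdgeCount valid , e+m≡
  where open Certificate P

pyramid-missingEdges : ∀ {d m} → MissingEdges d m → MissingEdges (suc d) m
pyramid-missingEdges {d} {m} (v , polytope@(exposed , _) , e , edgeCount , e+m≡) =
  pyramid v , pyramid-isPolytope v polytope (d ↑ʳ zero) ,
  d + 3 + e , pyramid-hasEdgeCount v exposed edgeCount ,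
  trans (+-assoc (d + 3) e m) (trans (cong (d + 3 +_) e+m≡) (sym ([1+n]C2≡n+nC2 (d + 3))))

missingEdges-≤′ : ∀ {k d m} → k ≤′ d → MissingEdges k m → MissingEdges d m
missingEdges-≤′ ≤′-refl        P = P
missingEdges-≤′ (≤′-step k≤′d) P = pyramid-missingEdges (missingEdges-≤′ k≤′d P)

missingEdges-4 : ∀ m → m ≤ 6 → MissingEdges 4 m
missingEdges-4 0 _ = certified-missingEdges cyclic-4-7 cyclic-4-7-valid refl
missingEdges-4 1 _ = certified-missingEdges fourPolytope-20-edges fourPolytope-20-edges-valid refl
missingEdges-4 2 _ = certified-missingEdges fourPolytope-19-edges fourPolytope-19-edges-valid refl
missingEdges-4 3 _ = pyramid-missingEdges
  (certified-missingEdges octahedron octahedron-valid refl)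
missingEdges-4 4 _ = pyramid-missingEdges
  (certified-missingEdges stackedSquarePyramid stackedSquarePyramid-valid refl)
missingEdges-4 5 _ = pyramid-missingEdges
  (certified-missingEdges pentagonalPyramid pentagonalPyramid-valid refl)
missingEdges-4 6 _ = pyramid-missingEdges
  (certified-missingEdges triangularPrism triangularPrism-valid refl)
missingEdges-4 (suc (suc (suc (suc (suc (suc (suc _))))))) (s≤s (s≤s (s≤s (s≤s (s≤s (s≤s ()))))))

missingEdges : ∀ {d m} → 4 ≤ d → m ≤ 6 → MissingEdges d m
missingEdges {m = m} 4≤d m≤6 = missingEdges-≤′ (≤⇒≤′ 4≤d) (missingEdges-4 m m≤6)

2*nC2+n≡n*n : ∀ n → 2 * (n C 2) + n ≡ n * n
2*nC2+n≡n*n zero    = refl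
2*nC2+n≡n*n (suc n) = begin
  2 * (suc n C 2) + suc n          ≡⟨ cong (λ t → 2 * t + suc n) ([1+n]C2≡n+nC2 n) ⟩
  2 * (n + n C 2) + suc n          ≡⟨ solve 2 (λ n c → con 2 :* (n :+ c) :+ (con 1 :+ n) :=
                                                       con 2 :* c :+ n :+ (n :+ n :+ con 1)) refl n (n C 2) ⟩
  2 * (n C 2) + n + (n + n + 1)    ≡⟨ cong (_+ (n + n + 1)) (2*nC2+n≡n*n n) ⟩
  n * n + (n + n + 1)              ≡⟨ solve 1 (λ n → n :* n :+ (n :+ n :+ con 1) :=
                                                     (con 1 :+ n) :* (con 1 :+ n)) refl n ⟩
  suc n * suc n                    ∎
  where
  open ≡-Reasoning
  open +-*-Solver

[d+3]C2≡d+3+d[d+3]/2 : ∀ d → (d + 3) C 2 ≡ d + 3 + d * (d + 3) / 2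
[d+3]C2≡d+3+d[d+3]/2 d = begin
  (d + 3) C 2                          ≡⟨ cong (_C 2) (+-comm d 3) ⟩
  (3 + d) C 2                          ≡⟨ [1+n]C2≡n+nC2 (2 + d) ⟩
  (2 + d) + (2 + d) C 2                ≡⟨ cong ((2 + d) +_) ([1+n]C2≡n+nC2 (1 + d)) ⟩
  (2 + d) + ((1 + d) + (1 + d) C 2)    ≡⟨ cong (λ t → (2 + d) + ((1 + d) + t)) ([1+n]C2≡n+nC2 d) ⟩
  (2 + d) + ((1 + d) + (d + d C 2))    ≡⟨ solve 2 (λ d c → (con 2 :+ d) :+ ((con 1 :+ d) :+ (d :+ c)) :=
                                                           d :+ con 3 :+ (c :+ con 2 :* d)) refl d (d C 2) ⟩
  d + 3 + (d C 2 + 2 * d)              ≡⟨ cong (d + 3 +_) half ⟨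
  d + 3 + d * (d + 3) / 2              ∎
  where
  open ≡-Reasoning
  open +-*-Solver
  double : d * (d + 3) ≡ (d C 2 + 2 * d) * 2
  double = begin
    d * (d + 3)               ≡⟨ solve 1 (λ d → d :* (d :+ con 3) := d :* d :+ con 3 :* d) refl d ⟩
    d * d + 3 * d             ≡⟨ cong (_+ 3 * d) (2*nC2+n≡n*n d) ⟨
    2 * (d C 2) + d + 3 * d   ≡⟨ solve 2 (λ d c → con 2 :* c :+ d :+ con 3 :* d :=
                                                   (c :+ con 2 :* d) :* con 2) refl d (d C 2) ⟩
    (d C 2 + 2 * d) * 2       ∎
  half : d * (d + 3) / 2 ≡ d C 2 + 2 * d
  half = trans (cong (_/ 2) double) (m*n/n≡m (d C 2 + 2 * d) 2)

missing⇒edgeCount : ∀ {d x e} → x ≤ d + 3 → e + (d + 3 ∸ x) ≡ (d + 3) C 2 → e ≡ x + d * (d + 3) / 2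
missing⇒edgeCount {d} {x} {e} x≤d+3 e+m≡ = +-cancelʳ-≡ m e (x + h) (begin
  e + m          ≡⟨ e+m≡ ⟩
  (d + 3) C 2    ≡⟨ [d+3]C2≡d+3+d[d+3]/2 d ⟩
  d + 3 + h      ≡⟨ cong (_+ h) (m+[n∸m]≡n x≤d+3) ⟨
  x + m + h      ≡⟨ +-assoc x m h ⟩
  x + (m + h)    ≡⟨ cong (x +_) (+-comm m h) ⟩
  x + (h + m)    ≡⟨ +-assoc x h m ⟨
  x + h + m      ∎)
  where
  open ≡-Reasoning
  m = d + 3 ∸ x
  h = d * (d + 3) / 2

lemma14 : (d x : ℕ) → 4 ≤ d → d ≤ x + 3 → x ≤ d + 3 →
    Σ (Fin (d + 3) → Point d) λ v →
      IsPolytope d (d + 3) v × HasEdgeCount v (x + (d * (d + 3)) / 2)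
lemma14 d x 4≤d d≤x+3 x≤d+3 =
  let v , polytope , e , edgeCount , e+m≡ = missingEdges 4≤d m≤6
  in  v , polytope , subst (HasEdgeCount v) (missing⇒edgeCount x≤d+3 e+m≡) edgeCount
  where
  m≤6 : d + 3 ∸ x ≤ 6
  m≤6 = m≤n+o⇒m∸n≤o (d + 3) x (subst (d + 3 ≤_) (+-assoc x 3 3) (+-monoˡ-≤ 3 d≤x+3))
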